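{- Let $a\in A$ and let $P_1\triangleleft a\triangleright P_2$ and $Q_1\triangleleft a\triangleright Q_2$ be basic forms (elements of $\mathbf{BF}$). If $P_1\triangleleft a\triangleright P_2=_{fr}Q_1\triangleleft a\triangleright Q_2$, then $P_1=_{fr}Q_1$ and $P_2=_{fr}Q_2$.
   Context: Fix a finite non-empty set $A$ of atomic propositions. Closed terms are built from $T$, $F$, $a\in A$ by conditional composition $P\triangleleft Q\triangleright R$. $\mathbf{BF}$ is the smallest set of closed terms containing $T,F$ and closed under $P,Q\mapsto P\triangleleft a\triangleright Q$ for $a\in A$. A reactive valuation algebra (RVA) is a set $RV$ with elements $T_{RV},F_{RV}$ and for each $a\in A$ functions $y_a:RV\to\{T,F\}$, $\partial_a:RV\to RV$ with $y_a(T_{RV})=T$, $y_a(F_{RV})=F$, $\partial_a(T_{RV})=T_{RV}$, $\partial_a(F_{RV})=F_{RV}$. For closed $P$ and $H\in RV$: $T/H=T$, $F/H=F$, $a/H=y_a(H)$, $\partial_T(H)=\partial_F(H)=H$; $(P\triangleleft Q\triangleright R)/H=P/\partial_Q(H)$ and $\partial_{P\triangleleft Q\triangleright R}(H)=\partial_P(\partial_Q(H))$ if $Q/H=T$, and $R/\partial_Q(H)$ resp. $\partial_R(\partial_Q(H))$ if $Q/H=F$. $P\equiv_{fr}Q$ means $P/H=Q/H$ for all RVAs and all $H$; $=_{fr}$ is the largest congruence (w.r.t. conditional composition) on closed terms contained in $\equiv_{fr}$. -}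

module Defs where

open import Data.Bool using (Bool; true; false; if_then_else_)
open import Data.Fin using (Fin)
open import Data.Nat using (ℕ; suc)
open import Data.Product using (Σ; _×_)
open import Level using (Level; _⊔_) renaming (suc to lsuc; zero to lzero)
open import Relation.Binary.PropositionalEquality using (_≡_)
open import Relation.Binary.Structures using (IsEquivalence)

-- The finite non-empty set A of atoms is Fin (suc n).
-- Truth values {T,F} are represented by Bool (true = T, false = F).

data Term (n : ℕ) : Set where
  T F  : Term n
  atom : Fin (suc n) → Term n
  _◁_▷_ : Term n → Term n → Term n → Term n

data BF {n : ℕ} : Term n → Set where
  bf-T : BF T
  bf-F : BF F
  bf-◁ : ∀ {P Q} (a : Fin (suc n)) → BF P → BF Q → BF (P ◁ atom a ▷ Q)

record RVA (n : ℕ) : Set₁ where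
  field
    Carrier : Set
    TRV FRV : Carrier
    y : Fin (suc n) → Carrier → Bool
    ∂ : Fin (suc n) → Carrier → Carrier
    y-T : ∀ a → y a TRV ≡ true
    y-F : ∀ a → y a FRV ≡ false
    ∂-T : ∀ a → ∂ a TRV ≡ TRV
    ∂-F : ∀ a → ∂ a FRV ≡ FRV

module _ {n : ℕ} (V : RVA n) where
  open RVA V

  mutual
    reply : Term n → Carrier → Bool
    reply T H = true
    reply F H = false
    reply (atom a) H = y a H
    reply (P ◁ Q ▷ R) H =
      if reply Q H then reply P (der Q H) else reply R (der Q H)

    der : Term n → Carrier → Carrier
    der T H = H
    der F H = H
    der (atom a) H = ∂ a H
    der (P ◁ Q ▷ R) H =
      if reply Q H then der P (der Q H) else der R (der Q H)

_≡fr_ : ∀ {n} → Term n → Term n → Set₁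
_≡fr_ {n} P Q = (V : RVA n) (H : RVA.Carrier V) → reply V P H ≡ reply V Q H

record IsCongruence {n : ℕ} (R : Term n → Term n → Set₁) : Set₁ where
  field
    isEquivalence : IsEquivalence R
    cong-◁▷ : ∀ {P P' Q Q' S S'} → R P P' → R Q Q' → R S S' →
              R (P ◁ Q ▷ S) (P' ◁ Q' ▷ S')

-- P =fr Q : related by the largest congruence contained in ≡fr,
-- i.e. related by some congruence contained in ≡fr (the largest such
-- congruence is the union of all of them).
_=fr_ : ∀ {n} → Term n → Term n → Set₂
_=fr_ {n} P Q =
  Σ (Term n → Term n → Set₁) λ R →
    IsCongruence R × (∀ {X Y} → R X Y → X ≡fr Y) × R P Q

-- Since =fr is a congruence, P =fr Q gives Z ◁ P ▷ Z ≡fr Z ◁ Q ▷ Z for every Z: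
-- P and Q agree on their reply and on every reply after their derivative.
-- That already separates distinct basic forms.  Adjoining to an RVA a fresh
-- initial state that answers b to every atom and then moves to H makes the
-- branch selected by b of P₁ ◁ a ▷ P₂ behave like P₁ or P₂ at H, and an RVA
-- that records the first atom it is asked about reveals the atom at the root.
-- So the two basic forms are syntactically equal, and their branches are
-- trivially =fr.
module Submission where

open import Defs
open import Data.Nat using (ℕ; suc)
open import Data.Fin using (Fin)
open import Data.Fin.Properties using (_≟_)
open import Data.Product using (_×_; _,_; proj₁; proj₂)
open import Data.Bool using (Bool; true; false)
open import Data.Bool.Properties using (if-eta)
open import Data.Maybe using (Maybe; just; nothing)
open import Data.Empty using (⊥-elim)
open import Level using (Lift; lift; lower)
open import Relation.Nullary using (¬_; does; yes; no)
open import Relation.Nullary.Decidable using (dec-true; dec-false)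
open import Relation.Binary.PropositionalEquality
  using (_≡_; _≢_; refl; sym; trans; cong; cong₂; ≢-sym; module ≡-Reasoning)
open import Relation.Binary.Structures using (IsEquivalence)

private
  variable
    n : ℕ

true≢false : true ≢ false
true≢false ()

Indistinguishable : (V : RVA n) → RVA.Carrier V → Term n → Term n → Set
Indistinguishable V H X Y =
  (reply V X H ≡ reply V Y H) ×
  (∀ Z → reply V Z (der V X H) ≡ reply V Z (der V Y H))

record _≡fr⁺_ (X Y : Term n) : Set₁ where
  constructor indistinguishable
  field
    at : (V : RVA n) (H : RVA.Carrier V) → Indistinguishable V H X Y

open _≡fr⁺_

≡fr⁺-sym : {X Y : Term n} → X ≡fr⁺ Y → Y ≡fr⁺ X
≡fr⁺-sym eq = indistinguishable λ V H →
  sym (proj₁ (at eq V H)) , λ Z → sym (proj₂ (at eq V H) Z)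

=fr⇒≡fr⁺ : {X Y : Term n} → X =fr Y → X ≡fr⁺ Y
=fr⇒≡fr⁺ {X = X} {Y} (R , isCongruence , R⊆≡fr , XRY) = indistinguishable λ V H →
  R⊆≡fr XRY V H , λ Z → begin
    reply V Z (der V X H)  ≡⟨ if-eta (reply V X H) ⟨
    reply V (Z ◁ X ▷ Z) H  ≡⟨ R⊆≡fr (cong-◁▷ (R-refl {Z}) XRY (R-refl {Z})) V H ⟩
    reply V (Z ◁ Y ▷ Z) H  ≡⟨ if-eta (reply V Y H) ⟩
    reply V Z (der V Y H)  ∎
  where
  open IsCongruence isCongruence
  open IsEquivalence isEquivalence using () renaming (refl to R-refl)
  open ≡-Reasoning

=fr-refl : {X : Term n} → X =fr X
=fr-refl {n} =
  (λ X Y → Lift _ (X ≡ Y)) ,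
  record
    { isEquivalence = record
        { refl  = lift refl
        ; sym   = λ p → lift (sym (lower p))
        ; trans = λ p q → lift (trans (lower p) (lower q))
        }
    ; cong-◁▷ = λ p q r → lift (cong₃ (lower p) (lower q) (lower r))
    } ,
  (λ p V H → cong (λ Z → reply V Z H) (lower p)) ,
  lift refl
  where
  cong₃ : {P P′ Q Q′ S S′ : Term n} →
          P ≡ P′ → Q ≡ Q′ → S ≡ S′ → (P ◁ Q ▷ S) ≡ (P′ ◁ Q′ ▷ S′)
  cong₃ refl refl refl = refl

module _ (V : RVA n) (H : RVA.Carrier V) (b : Bool) where
  open RVA V

  -- nothing is the fresh initial state; the old states are embedded by just.
  prefixState : RVA n
  prefixState = record
    { Carrier = Maybe Carrier
    ; TRV = just TRV ; FRV = just FRV ; y = y′ ; ∂ = ∂′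
    ; y-T = y-T ; y-F = y-F
    ; ∂-T = λ a → cong just (∂-T a) ; ∂-F = λ a → cong just (∂-F a)
    }
    where
    y′ : Fin (suc n) → Maybe Carrier → Bool
    y′ _ nothing  = b
    y′ c (just x) = y c x
    ∂′ : Fin (suc n) → Maybe Carrier → Maybe Carrier
    ∂′ _ nothing  = just H
    ∂′ c (just x) = just (∂ c x)

  prefixState-simulates : ∀ X x →
    (reply prefixState X (just x) ≡ reply V X x) ×
    (der prefixState X (just x) ≡ just (der V X x))
  prefixState-simulates T        x = refl , refl
  prefixState-simulates F        x = refl , refl
  prefixState-simulates (atom a) x = refl , refl
  prefixState-simulates (P ◁ Q ▷ R) x
    rewrite proj₁ (prefixState-simulates Q x) | proj₂ (prefixState-simulates Q x)
    with reply V Q x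
  ... | true  = prefixState-simulates P (der V Q x)
  ... | false = prefixState-simulates R (der V Q x)

  prefixState-reflects : ∀ X Y →
    Indistinguishable prefixState (just H) X Y → Indistinguishable V H X Y
  prefixState-reflects X Y (sameReply , sameFuture) =
    trans (sym (reply≡ X H)) (trans sameReply (reply≡ Y H)) ,
    λ Z → trans (sym (future≡ X Z)) (trans (sameFuture Z) (future≡ Y Z))
    where
    reply≡ : ∀ W x → reply prefixState W (just x) ≡ reply V W x
    reply≡ W x = proj₁ (prefixState-simulates W x)
    future≡ : ∀ W Z →
      reply prefixState Z (der prefixState W (just H)) ≡ reply V Z (der V W H)
    future≡ W Z = trans (cong (reply prefixState Z) (proj₂ (prefixState-simulates W H)))
                        (reply≡ Z (der V W H))

≡fr⁺-branches : ∀ {a} {P₁ P₂ Q₁ Q₂ : Term n} →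
  (P₁ ◁ atom a ▷ P₂) ≡fr⁺ (Q₁ ◁ atom a ▷ Q₂) → (P₁ ≡fr⁺ Q₁) × (P₂ ≡fr⁺ Q₂)
≡fr⁺-branches {n} {a} {P₁} {P₂} {Q₁} {Q₂} eq =
  indistinguishable (λ V H → prefixState-reflects V H true  P₁ Q₁ (rootAt true  V H)) ,
  indistinguishable (λ V H → prefixState-reflects V H false P₂ Q₂ (rootAt false V H))
  where
  rootAt : ∀ b (V : RVA n) H → Indistinguishable (prefixState V H b) nothing
                                 (P₁ ◁ atom a ▷ P₂) (Q₁ ◁ atom a ▷ Q₂)
  rootAt b V H = at eq (prefixState V H b) nothing

data FirstAtomState (n : ℕ) : Set where
  ⊤-state ⊥-state : FirstAtomState n
  recorded        : Maybe (Fin (suc n)) → FirstAtomState n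

-- recorded nothing: no atom asked yet; recorded (just d): d was asked first.
firstAtom : (n : ℕ) → RVA n
firstAtom n = record
  { Carrier = FirstAtomState n
  ; TRV = ⊤-state ; FRV = ⊥-state ; y = y ; ∂ = ∂
  ; y-T = λ _ → refl ; y-F = λ _ → refl ; ∂-T = λ _ → refl ; ∂-F = λ _ → refl
  }
  where
  y : Fin (suc n) → FirstAtomState n → Bool
  y _ ⊤-state             = true
  y _ ⊥-state             = false
  y _ (recorded nothing)  = false
  y c (recorded (just d)) = does (c ≟ d)
  ∂ : Fin (suc n) → FirstAtomState n → FirstAtomState n
  ∂ _ ⊤-state             = ⊤-state
  ∂ _ ⊥-state             = ⊥-state
  ∂ c (recorded nothing)  = recorded (just c)
  ∂ _ (recorded (just d)) = recorded (just d)

firstAtom-der-recorded : ∀ (X : Term n) d →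
  der (firstAtom n) X (recorded (just d)) ≡ recorded (just d)
firstAtom-der-recorded T        d = refl
firstAtom-der-recorded F        d = refl
firstAtom-der-recorded (atom a) d = refl
firstAtom-der-recorded {n} (P ◁ Q ▷ R) d
  rewrite firstAtom-der-recorded Q d
        | firstAtom-der-recorded P d
        | firstAtom-der-recorded R d
  = if-eta (reply (firstAtom n) Q (recorded (just d)))

askedFirst : Term n → Fin (suc n) → Bool
askedFirst {n} X c = reply (firstAtom n) (atom c) (der (firstAtom n) X (recorded nothing))

askedFirst-◁ : ∀ {a} (P Q : Term n) c → askedFirst (P ◁ atom a ▷ Q) c ≡ does (c ≟ a)
askedFirst-◁ {n} {a} P Q c = cong (reply (firstAtom n) (atom c)) (firstAtom-der-recorded Q a)

≡fr⁺⇒askedFirst : {X Y : Term n} → X ≡fr⁺ Y → ∀ c → askedFirst X c ≡ askedFirst Y c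
≡fr⁺⇒askedFirst {n} eq c = proj₂ (at eq (firstAtom n) (recorded nothing)) (atom c)

¬askedFirst⇒¬≡fr⁺-◁ : ∀ {L : Term n} {a P Q} →
  askedFirst L a ≡ false → ¬ (L ≡fr⁺ (P ◁ atom a ▷ Q))
¬askedFirst⇒¬≡fr⁺-◁ {L = L} {a} {P} {Q} notAsked eq = true≢false (begin
  true                          ≡⟨ dec-true (a ≟ a) refl ⟨
  does (a ≟ a)                  ≡⟨ askedFirst-◁ P Q a ⟨
  askedFirst (P ◁ atom a ▷ Q) a ≡⟨ ≡fr⁺⇒askedFirst eq a ⟨
  askedFirst L a                ≡⟨ notAsked ⟩
  false                         ∎)
  where open ≡-Reasoning

basicForm-≡fr⁺⇒≡ : {X Y : Term n} → BF X → BF Y → X ≡fr⁺ Y → X ≡ Y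
basicForm-≡fr⁺⇒≡ bf-T bf-T _ = refl
basicForm-≡fr⁺⇒≡ bf-F bf-F _ = refl
basicForm-≡fr⁺⇒≡ {n} bf-T bf-F eq = ⊥-elim (true≢false (proj₁ (at eq (firstAtom n) ⊤-state)))
basicForm-≡fr⁺⇒≡ {n} bf-F bf-T eq = ⊥-elim (true≢false (proj₁ (at (≡fr⁺-sym eq) (firstAtom n) ⊤-state)))
basicForm-≡fr⁺⇒≡ bf-T (bf-◁ _ _ _) eq = ⊥-elim (¬askedFirst⇒¬≡fr⁺-◁ refl eq)
basicForm-≡fr⁺⇒≡ bf-F (bf-◁ _ _ _) eq = ⊥-elim (¬askedFirst⇒¬≡fr⁺-◁ refl eq)
basicForm-≡fr⁺⇒≡ (bf-◁ _ _ _) bf-T eq = ⊥-elim (¬askedFirst⇒¬≡fr⁺-◁ refl (≡fr⁺-sym eq))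
basicForm-≡fr⁺⇒≡ (bf-◁ _ _ _) bf-F eq = ⊥-elim (¬askedFirst⇒¬≡fr⁺-◁ refl (≡fr⁺-sym eq))
basicForm-≡fr⁺⇒≡ (bf-◁ {P₁} {P₂} a p₁ p₂) (bf-◁ b q₁ q₂) eq with a ≟ b
... | yes refl = cong₂ (λ X Y → X ◁ atom a ▷ Y)
                   (basicForm-≡fr⁺⇒≡ p₁ q₁ (proj₁ (≡fr⁺-branches eq)))
                   (basicForm-≡fr⁺⇒≡ p₂ q₂ (proj₂ (≡fr⁺-branches eq)))
... | no a≢b = ⊥-elim (¬askedFirst⇒¬≡fr⁺-◁ bNotAsked eq)
  where
  bNotAsked : askedFirst (P₁ ◁ atom a ▷ P₂) b ≡ false
  bNotAsked = trans (askedFirst-◁ P₁ P₂ b) (dec-false (b ≟ a) (≢-sym a≢b))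

mainTheorem18 : (n : ℕ) (a : Fin (suc n)) (P₁ P₂ Q₁ Q₂ : Term n) →
    BF (P₁ ◁ atom a ▷ P₂) → BF (Q₁ ◁ atom a ▷ Q₂) →
    (P₁ ◁ atom a ▷ P₂) =fr (Q₁ ◁ atom a ▷ Q₂) →
    (P₁ =fr Q₁) × (P₂ =fr Q₂)
mainTheorem18 n a P₁ P₂ Q₁ Q₂ bfP bfQ eq
  with refl ← basicForm-≡fr⁺⇒≡ bfP bfQ (=fr⇒≡fr⁺ eq)
  = =fr-refl , =fr-refl
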